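{- Let $m\ge1$, let $\{a_n\}_{n\ge0}$ be the $m$-gonal sequence, and for $n,k\ge0$ let $p_{n,k}$ be the number of integers in $[0,a_{mn+1})$ whose legal $m$-gonal decomposition has exactly $k$ summands. Then the generating function $F(x,y)=\sum_{n,k\ge0}p_{n,k}x^ny^k$ satisfies \[ F(x,y)=\frac{1+y}{1-(my+1)x} \] as formal power series.
   Context: Bins of an increasing sequence $\{a_n\}_{n\ge0}$: $b_0=[a_0]$, $b_k=[a_{m(k-1)+1},\dots,a_{mk}]$ for $k\ge1$. A legal $m$-gonal decomposition of $z$ is $z=a_{\ell_t}+\cdots+a_{\ell_1}$ with $\ell_1<\cdots<\ell_t$ and no two summands in the same bin ($0$ has the empty decomposition). The $m$-gonal sequence: each $a_i$ is the smallest positive integer with no legal $m$-gonal decomposition using only $a_0,\dots,a_{i-1}$. Every nonnegative integer has a unique legal $m$-gonal decomposition in terms of this sequence. -}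

module Defs where

open import Data.Nat as ℕ using (ℕ; zero; suc; _<_; NonZero)
open import Data.Nat.DivMod using (_/_)
open import Data.Integer as ℤ using (ℤ; +_)
open import Data.List using (List; map; length)
open import Data.Nat.ListAction using (sum)
open import Data.List.Relation.Unary.All using (All)
open import Data.List.Relation.Unary.AllPairs using (AllPairs)
open import Data.List.Relation.Unary.Unique.Propositional using (Unique)
open import Data.List.Membership.Propositional using (_∈_)
open import Data.Product using (Σ; _×_)
open import Function.Bundles using (_⇔_)
open import Relation.Nullary using (¬_)
open import Relation.Binary.PropositionalEquality using (_≡_; _≢_)

-- Bins of indices: b_0 = {0}, b_k = {m(k-1)+1, …, mk} for k ≥ 1.
-- bin m ℓ is the k with ℓ ∈ b_k.

bin : (m : ℕ) → .{{NonZero m}} → ℕ → ℕ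
bin m zero    = 0
bin m (suc l) = suc (l / m)

record LegalDec (m : ℕ) .{{_ : NonZero m}} (a : ℕ → ℕ) (z : ℕ) : Set where
  constructor legalDec
  field
    idx          : List ℕ
    increasing   : AllPairs _<_ idx
    distinctBins : AllPairs (λ i j → bin m i ≢ bin m j) idx
    sums         : sum (map a idx) ≡ z

open LegalDec public

LegalDecUsing : (m : ℕ) → .{{NonZero m}} → (ℕ → ℕ) → ℕ → ℕ → Set
LegalDecUsing m a i z = Σ (LegalDec m a z) λ d → All (_< i) (idx d)

LegalDecWith : (m : ℕ) → .{{NonZero m}} → (ℕ → ℕ) → ℕ → ℕ → Set
LegalDecWith m a z k = Σ (LegalDec m a z) λ d → length (idx d) ≡ k

IsMGonalSequence : (m : ℕ) → .{{NonZero m}} → (ℕ → ℕ) → Set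
IsMGonalSequence m a = ∀ i →
  (0 < a i)
  × ¬ LegalDecUsing m a i (a i)
  × (∀ z → 0 < z → z < a i → LegalDecUsing m a i z)

IsCount : ℕ → (ℕ → Set) → ℕ → Set
IsCount N P c = Σ (List ℕ) λ L →
  Unique L × (length L ≡ c) × (∀ z → (z ∈ L) ⇔ ((z < N) × P z))

-- Formal power series in two variables x, y with integer coefficients:
-- f n k is the coefficient of x^n y^k.

PS : Set
PS = ℕ → ℕ → ℤ

sumTo : (ℕ → ℤ) → ℕ → ℤ
sumTo f zero    = f zero
sumTo f (suc n) = sumTo f n ℤ.+ f (suc n)

_+ₛ_ : PS → PS → PS
(f +ₛ g) n k = f n k ℤ.+ g n k

_-ₛ_ : PS → PS → PS
(f -ₛ g) n k = f n k ℤ.- g n k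

_*ₛ_ : PS → PS → PS
(f *ₛ g) n k = sumTo (λ i → sumTo (λ j → f i j ℤ.* g (n ℕ.∸ i) (k ℕ.∸ j)) k) n

_·ₛ_ : ℕ → PS → PS
(c ·ₛ f) n k = + c ℤ.* f n k

1ₛ : PS
1ₛ zero zero = + 1
1ₛ _    _    = + 0

Xₛ : PS
Xₛ (suc zero) zero = + 1
Xₛ _          _    = + 0

Yₛ : PS
Yₛ zero (suc zero) = + 1
Yₛ _    _          = + 0

_≈ₛ_ : PS → PS → Set
f ≈ₛ g = ∀ n k → f n k ≡ g n k

infixl 6 _+ₛ_ _-ₛ_
infixl 7 _*ₛ_ _·ₛ_
infix 4 _≈ₛ_

genFun : (ℕ → ℕ → ℕ) → PS
genFun p n k = + p n k

module Submission where

-- Index the bins b_0 = {0}, b_c = {m(c-1)+1, …, mc}, write first c for the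
-- first index of b_c and size c for its length.  The m-gonal sequence has
-- the closed form A with A (first c + t) = (t+1)·V c for t < size c, where
-- V 0 = 1 and V (c+1) = (size c + 1)·V c; equivalently A (ℓ+1) = A ℓ + V (bin ℓ).
-- From this recurrence:
--   * every legal decomposition using indices below i sums to less than A i
--     ('sum-bound'), and every z < A i has such a decomposition ('represent');
--   * hence any m-gonal sequence equals A ('mgonal≡A').
-- A legal decomposition of z < V (c+1) either avoids b_c (then z < V c) or
-- ends with the t-th term of b_c, leaving a decomposition of z - (t+1)·V c
-- below V c.  So the lists L c k defined by this recursion enumerate the
-- z < V c with k terms ('enumerates'), and their lengths satisfy
-- p (n+1) (k+1) = p n (k+1) + m·p n k.  Finally a general computation with
-- power series supported on {0,1}² ('recurrence⇒series') turns this
-- recurrence into F · (1 - (my+1)x) = 1 + y.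

open import Defs
open import Data.Nat using (ℕ; NonZero; _*_; _+_; zero; suc; _≤_; _<_; _∸_; z≤n; s≤s; _≤′_; ≤′-refl; ≤′-step; _<?_; s≤s⁻¹; >-nonZero⁻¹)
open import Data.Nat.Properties
open import Data.Nat.DivMod using (_/_; _%_; m≡m%n+[m/n]*n; m%n<n; [m+kn]%n≡m%n; m<n⇒m%n≡m; +-distrib-/-∣ˡ; m*n/n≡m; m<n⇒m/n≡0; /-monoˡ-≤)
open import Data.Nat.Divisibility using (n∣m*n)
open import Algebra.Properties.CommutativeSemigroup +-commutativeSemigroup using (xy∙z≈y∙xz)
open import Data.Nat.Induction using (<-rec)
open import Data.Nat.ListAction using (sum)
open import Data.Nat.ListAction.Properties using (sum-++)
open import Data.List using (List; []; _∷_; _++_; _∷ʳ_; [_]; map; length; initLast; _∷ʳ′_)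
open import Data.List.Properties using (map-++; length-++; length-map; map-cong-local)
open import Data.List.Relation.Unary.All as All using (All; []; _∷_)
import Data.List.Relation.Unary.All.Properties as AllP
open import Data.List.Relation.Unary.AllPairs as AP using (AllPairs; []; _∷_)
import Data.List.Relation.Unary.AllPairs.Properties as APP
open import Data.List.Membership.Propositional using (_∈_)
open import Data.List.Membership.Propositional.Properties using (∈-++⁻; ∈-++⁺ˡ; ∈-++⁺ʳ; ∈-map⁻; ∈-map⁺)
open import Data.List.Relation.Unary.Any using (here)
open import Data.Product using (Σ; _×_; _,_; proj₁; proj₂)
import Data.Product as Product
open import Data.Sum using (inj₁; inj₂)
open import Data.Empty using (⊥-elim)
open import Function using (_∘_)
open import Function.Bundles using (mk⇔)
open import Relation.Binary using (tri<; tri≈; tri>)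
open import Relation.Nullary using (yes; no)
open import Relation.Binary.PropositionalEquality
  using (_≡_; _≢_; refl; sym; trans; cong; cong₂; subst; subst₂; module ≡-Reasoning)

AllPairs-∷ʳ⁻ : ∀ {A : Set} {R : A → A → Set} xs {y} →
               AllPairs R (xs ∷ʳ y) → AllPairs R xs × All (λ x → R x y) xs
AllPairs-∷ʳ⁻ []       _           = [] , []
AllPairs-∷ʳ⁻ (x ∷ xs) (Rx ∷ Rxs) with AllP.∷ʳ⁻ Rx | AllPairs-∷ʳ⁻ xs Rxs
... | Rx-xs , Rxy | Rxs′ , Rxs-y = (Rx-xs ∷ Rxs′) , (Rxy ∷ Rxs-y)

length-∷ʳ : ∀ {A : Set} (xs : List A) y → length (xs ∷ʳ y) ≡ suc (length xs)
length-∷ʳ xs y = trans (length-++ xs) (+-comm (length xs) 1)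

sum-map-∷ʳ : ∀ {A : Set} (f : A → ℕ) xs y → sum (map f (xs ∷ʳ y)) ≡ sum (map f xs) + f y
sum-map-∷ʳ f xs y = begin
  sum (map f (xs ++ [ y ]))        ≡⟨ cong sum (map-++ f xs [ y ]) ⟩
  sum (map f xs ++ [ f y ])        ≡⟨ sum-++ (map f xs) [ f y ] ⟩
  sum (map f xs) + (f y + 0)       ≡⟨ cong (sum (map f xs) +_) (+-identityʳ (f y)) ⟩
  sum (map f xs) + f y             ∎
  where open ≡-Reasoning

-- Shifted blocks: blocks v xs j lists (t+1)·v + x for t = 0, …, j-1 and x ∈ xs.
-- For x < v these are j disjoint translates of xs, sitting in [v, (j+1)·v).

blocks : ℕ → List ℕ → ℕ → List ℕ
blocks v xs zero    = []
blocks v xs (suc j) = blocks v xs j ++ map (suc j * v +_) xs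

blocks-length : ∀ v xs j → length (blocks v xs j) ≡ j * length xs
blocks-length v xs zero    = refl
blocks-length v xs (suc j) = begin
  length (blocks v xs j ++ map (suc j * v +_) xs)       ≡⟨ length-++ (blocks v xs j) ⟩
  length (blocks v xs j) + length (map (suc j * v +_) xs) ≡⟨ cong₂ _+_ (blocks-length v xs j) (length-map _ xs) ⟩
  j * length xs + length xs                               ≡⟨ +-comm (j * length xs) (length xs) ⟩
  suc j * length xs                                       ∎
  where open ≡-Reasoning

blocks-mem⁻ : ∀ {v xs z} j → z ∈ blocks v xs j →
              Σ ℕ λ t → Σ ℕ λ x → t < j × x ∈ xs × z ≡ suc t * v + x
blocks-mem⁻ {v} {xs} (suc j) z∈ with ∈-++⁻ (blocks v xs j) z∈
... | inj₁ z∈old = Product.map₂ (Product.map₂ (Product.map₁ m<n⇒m<1+n)) (blocks-mem⁻ j z∈old)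
... | inj₂ z∈new with ∈-map⁻ (suc j * v +_) z∈new
...   | x , x∈ , eq = j , x , n<1+n j , x∈ , eq

blocks-mem⁺ : ∀ {v xs t x} j → t < j → x ∈ xs → suc t * v + x ∈ blocks v xs j
blocks-mem⁺ {v} {xs} {t} (suc j) t< x∈ with m≤n⇒m<n∨m≡n (s≤s⁻¹ t<)
... | inj₁ t<j  = ∈-++⁺ˡ (blocks-mem⁺ j t<j x∈)
... | inj₂ refl = ∈-++⁺ʳ (blocks v xs t) (∈-map⁺ (suc t * v +_) x∈)

block-bound : ∀ {v t j x} → t < j → x < v → suc t * v + x < suc j * v
block-bound {v} {t} {j} {x} t<j x<v = begin-strict
  suc t * v + x        <⟨ +-monoʳ-< (suc t * v) x<v ⟩
  suc t * v + v        ≡⟨ +-comm (suc t * v) v ⟩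
  suc (suc t) * v      ≤⟨ *-monoˡ-≤ v (s≤s t<j) ⟩
  suc j * v            ∎
  where open ≤-Reasoning

blocks-bounds : ∀ {v xs} j → All (_< v) xs → All (λ z → v ≤ z × z < suc j * v) (blocks v xs j)
blocks-bounds {v} {xs} j xs<v = All.tabulate (bounds ∘ blocks-mem⁻ j)
  where
  bounds : ∀ {z} → (Σ ℕ λ t → Σ ℕ λ x → t < j × x ∈ xs × z ≡ suc t * v + x) → v ≤ z × z < suc j * v
  bounds (t , x , t<j , x∈ , refl) =
    ≤-trans (m≤m+n v (t * v)) (m≤m+n (suc t * v) x) , block-bound t<j (All.lookup xs<v x∈)

blocks-sorted : ∀ {v xs} j → All (_< v) xs → AllPairs _<_ xs → AllPairs _<_ (blocks v xs j)
blocks-sorted zero _ _ = []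
blocks-sorted {v} {xs} (suc j) xs<v sorted =
  APP.++⁺ (blocks-sorted j xs<v sorted)
          (APP.map⁺ (AP.map (+-monoʳ-< (suc j * v)) sorted))
          (All.map below-new-block (blocks-bounds j xs<v))
  where
  below-new-block : ∀ {z} → v ≤ z × z < suc j * v → All (z <_) (map (suc j * v +_) xs)
  below-new-block (_ , z<) = AllP.map⁺ (All.universal (λ x → <-≤-trans z< (m≤m+n (suc j * v) x)) xs)

-- Products with two-variable power series supported on {0,1} × {0,1}

module PowerSeries where
  open import Data.Integer as Z using (ℤ; +_; -_)
  import Data.Integer.Properties as ZP
  open import Data.Integer.Tactic.RingSolver using (solve-∀)

  sumTo-cong : ∀ {f g} n → (∀ i → f i ≡ g i) → sumTo f n ≡ sumTo g n
  sumTo-cong zero    f≡g = f≡g 0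
  sumTo-cong (suc n) f≡g = cong₂ Z._+_ (sumTo-cong n f≡g) (f≡g (suc n))

  sumTo-+ : ∀ f g n → sumTo (λ i → f i Z.+ g i) n ≡ sumTo f n Z.+ sumTo g n
  sumTo-+ f g zero    = refl
  sumTo-+ f g (suc n) =
    trans (cong (Z._+ (f (suc n) Z.+ g (suc n))) (sumTo-+ f g n))
          (interchange (sumTo f n) (sumTo g n) (f (suc n)) (g (suc n)))
    where
    interchange : ∀ a b c d → (a Z.+ b) Z.+ (c Z.+ d) ≡ (a Z.+ c) Z.+ (b Z.+ d)
    interchange = solve-∀

  sumTo-zero : ∀ {f} n → (∀ i → i ≤ n → f i ≡ + 0) → sumTo f n ≡ + 0
  sumTo-zero zero    f≡0 = f≡0 0 z≤n
  sumTo-zero (suc n) f≡0 =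
    cong₂ Z._+_ (sumTo-zero n (λ i i≤n → f≡0 i (m≤n⇒m≤1+n i≤n))) (f≡0 (suc n) ≤-refl)

  prev : (ℕ → ℤ) → ℕ → ℤ
  prev f zero    = + 0
  prev f (suc n) = f n

  module _ (f e : ℕ → ℤ) (e-short : ∀ t → e (suc (suc t)) ≡ + 0) where

    conv-tail : ∀ n → sumTo (λ i → f i Z.* e (suc n ∸ i)) n ≡ f n Z.* e 1
    conv-tail zero    = refl
    conv-tail (suc n) =
      trans (cong₂ (λ s r → s Z.+ f (suc n) Z.* e r) (sumTo-zero n vanish) (m+n∸n≡m 1 n))
            (ZP.+-identityˡ (f (suc n) Z.* e 1))
      where
      vanish : ∀ i → i ≤ n → f i Z.* e (suc (suc n) ∸ i) ≡ + 0
      vanish i i≤n = trans (cong (λ r → f i Z.* e r) (+-∸-assoc 2 i≤n))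
                           (trans (cong (f i Z.*_) (e-short (n ∸ i))) (ZP.*-zeroʳ (f i)))

    conv-short : ∀ n → sumTo (λ i → f i Z.* e (n ∸ i)) n ≡ f n Z.* e 0 Z.+ prev f n Z.* e 1
    conv-short zero    = sym (ZP.+-identityʳ (f 0 Z.* e 0))
    conv-short (suc n) = begin
      sumTo (λ i → f i Z.* e (suc n ∸ i)) n Z.+ f (suc n) Z.* e (n ∸ n)
        ≡⟨ cong₂ (λ s r → s Z.+ f (suc n) Z.* e r) (conv-tail n) (n∸n≡0 n) ⟩
      f n Z.* e 1 Z.+ f (suc n) Z.* e 0
        ≡⟨ ZP.+-comm (f n Z.* e 1) (f (suc n) Z.* e 0) ⟩
      f (suc n) Z.* e 0 Z.+ f n Z.* e 1 ∎
      where open ≡-Reasoning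

  Short : PS → Set
  Short g = (∀ i j → g (suc (suc i)) j ≡ + 0) × (∀ i j → g i (suc (suc j)) ≡ + 0)

  *ₛ-short : ∀ f g → Short g → ∀ n k →
    (f *ₛ g) n k ≡ (f n k Z.* g 0 0 Z.+ prev (λ i → f i k) n Z.* g 1 0)
                   Z.+ (prev (f n) k Z.* g 0 1 Z.+ prev (λ i → prev (f i) k) n Z.* g 1 1)
  *ₛ-short f g (x-short , y-short) n k = begin
    sumTo (λ i → sumTo (λ j → f i j Z.* g (n ∸ i) (k ∸ j)) k) n
      ≡⟨ sumTo-cong n (λ i → conv-short (f i) (g (n ∸ i)) (y-short (n ∸ i)) k) ⟩
    sumTo (λ i → f i k Z.* g (n ∸ i) 0 Z.+ prev (f i) k Z.* g (n ∸ i) 1) n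
      ≡⟨ sumTo-+ (λ i → f i k Z.* g (n ∸ i) 0) (λ i → prev (f i) k Z.* g (n ∸ i) 1) n ⟩
    sumTo (λ i → f i k Z.* g (n ∸ i) 0) n Z.+ sumTo (λ i → prev (f i) k Z.* g (n ∸ i) 1) n
      ≡⟨ cong₂ Z._+_ (conv-short (λ i → f i k) (λ w → g w 0) (λ t → x-short t 0) n)
                     (conv-short (λ i → prev (f i) k) (λ w → g w 1) (λ t → x-short t 1) n) ⟩
    (f n k Z.* g 0 0 Z.+ prev (λ i → f i k) n Z.* g 1 0)
      Z.+ (prev (f n) k Z.* g 0 1 Z.+ prev (λ i → prev (f i) k) n Z.* g 1 1) ∎
    where open ≡-Reasoning

  *ₛ-congʳ : ∀ f {g g′} → g ≈ₛ g′ → f *ₛ g ≈ₛ f *ₛ g′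
  *ₛ-congʳ f g≈g′ n k = sumTo-cong n (λ i → sumTo-cong k (λ j → cong (f i j Z.*_) (g≈g′ (n ∸ i) (k ∸ j))))

  *ₛ-X : ∀ f n k → (f *ₛ Xₛ) n k ≡ prev (λ i → f i k) n
  *ₛ-X f n k = trans (*ₛ-short f Xₛ X-short n k)
                     (keep-x (f n k) (prev (λ i → f i k) n) (prev (f n) k) (prev (λ i → prev (f i) k) n))
    where
    X-short : Short Xₛ
    X-short = (λ _ _ → refl) , λ { zero _ → refl ; (suc zero) _ → refl ; (suc (suc _)) _ → refl }
    keep-x : ∀ a b c d → (a Z.* + 0 Z.+ b Z.* + 1) Z.+ (c Z.* + 0 Z.+ d Z.* + 0) ≡ b
    keep-x = solve-∀

  Gc : ℕ → PS
  Gc m 0 0 = + 1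
  Gc m 1 0 = - + 1
  Gc m 1 1 = - + m
  Gc m _ _ = + 0

  Gc-short : ∀ m → Short (Gc m)
  Gc-short m = (λ _ _ → refl) , λ { zero _ → refl ; (suc zero) _ → refl ; (suc (suc _)) _ → refl }

  G-coefficients : ∀ m → 1ₛ -ₛ (m ·ₛ Yₛ +ₛ 1ₛ) *ₛ Xₛ ≈ₛ Gc m
  G-coefficients m n k = trans (cong (λ h → 1ₛ n k Z.- h) (*ₛ-X (m ·ₛ Yₛ +ₛ 1ₛ) n k)) (coefficient n k)
    where
    no-term : ∀ y → + 0 Z.- (y Z.* + 0 Z.+ + 0) ≡ + 0
    no-term = solve-∀

    coefficient : ∀ n k → 1ₛ n k Z.- prev (λ i → (m ·ₛ Yₛ +ₛ 1ₛ) i k) n ≡ Gc m n k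
    coefficient zero          zero          = refl
    coefficient zero          (suc zero)    = refl
    coefficient zero          (suc (suc k)) = refl
    coefficient (suc zero)    zero          = x-term (+ m)
      where x-term : ∀ y → + 0 Z.- (y Z.* + 0 Z.+ + 1) ≡ - + 1
            x-term = solve-∀
    coefficient (suc zero)    (suc zero)    = xy-term (+ m)
      where xy-term : ∀ y → + 0 Z.- (y Z.* + 1 Z.+ + 0) ≡ - y
            xy-term = solve-∀
    coefficient (suc zero)    (suc (suc k)) = no-term (+ m)
    coefficient (suc (suc n)) k             = no-term (+ m)

  recurrence⇒series : ∀ m (p : ℕ → ℕ → ℕ) →
    p 0 0 ≡ 1 → p 0 1 ≡ 1 → (∀ k → p 0 (suc (suc k)) ≡ 0) →
    (∀ n → p (suc n) 0 ≡ p n 0) →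
    (∀ n k → p (suc n) (suc k) ≡ p n (suc k) + m * p n k) →
    genFun p *ₛ (1ₛ -ₛ (m ·ₛ Yₛ +ₛ 1ₛ) *ₛ Xₛ) ≈ₛ 1ₛ +ₛ Yₛ
  recurrence⇒series m p p00 p01 p0k p-suc0 p-suc n k = begin
    (F *ₛ (1ₛ -ₛ (m ·ₛ Yₛ +ₛ 1ₛ) *ₛ Xₛ)) n k ≡⟨ *ₛ-congʳ F (G-coefficients m) n k ⟩
    (F *ₛ Gc m) n k                          ≡⟨ *ₛ-short F (Gc m) (Gc-short m) n k ⟩
    (F n k Z.* + 1 Z.+ Fx Z.* - + 1) Z.+ (prev (F n) k Z.* + 0 Z.+ Fxy Z.* - + m)
      ≡⟨ collect (F n k) Fx (prev (F n) k) Fxy (+ m) ⟩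
    F n k Z.- Fx Z.- + m Z.* Fxy             ≡⟨ reduced n k ⟩
    (1ₛ +ₛ Yₛ) n k                           ∎
    where
    open ≡-Reasoning
    F : PS
    F = genFun p
    Fx Fxy : ℤ
    Fx  = prev (λ i → F i k) n
    Fxy = prev (λ i → prev (F i) k) n

    collect : ∀ a b c d y → (a Z.* + 1 Z.+ b Z.* - + 1) Z.+ (c Z.* + 0 Z.+ d Z.* - y) ≡ a Z.- b Z.- y Z.* d
    collect = solve-∀
    initial : ∀ k → + p 0 k ≡ (1ₛ +ₛ Yₛ) 0 k
    initial zero          = cong +_ p00
    initial (suc zero)    = cong +_ p01
    initial (suc (suc k)) = cong +_ (p0k k)

    reduced : ∀ n k →
      F n k Z.- prev (λ i → F i k) n Z.- + m Z.* prev (λ i → prev (F i) k) n ≡ (1ₛ +ₛ Yₛ) n k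
    reduced zero k = trans (no-shift (+ p 0 k) (+ m)) (initial k)
      where
      no-shift : ∀ a y → a Z.- + 0 Z.- y Z.* + 0 ≡ a
      no-shift = solve-∀
    reduced (suc n) zero =
      trans (cong (λ a → + a Z.- + p n 0 Z.- + m Z.* + 0) (p-suc0 n)) (cancel-0 (+ p n 0) (+ m))
      where
      cancel-0 : ∀ a y → a Z.- a Z.- y Z.* + 0 ≡ + 0
      cancel-0 = solve-∀
    reduced (suc n) (suc k) = begin
      + p (suc n) (suc k) Z.- + p n (suc k) Z.- + m Z.* + p n k
        ≡⟨ cong (λ a → + a Z.- + p n (suc k) Z.- + m Z.* + p n k) (p-suc n k) ⟩
      + (p n (suc k) + m * p n k) Z.- + p n (suc k) Z.- + m Z.* + p n k
        ≡⟨ cong (λ a → a Z.- + p n (suc k) Z.- + m Z.* + p n k)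
                (trans (ZP.pos-+ (p n (suc k)) (m * p n k)) (cong (λ b → + p n (suc k) Z.+ b) (ZP.pos-* m (p n k)))) ⟩
      (+ p n (suc k) Z.+ + m Z.* + p n k) Z.- + p n (suc k) Z.- + m Z.* + p n k
        ≡⟨ cancel (+ p n (suc k)) (+ m) (+ p n k) ⟩
      + 0 ∎
      where
      cancel : ∀ a y d → (a Z.+ y Z.* d) Z.- a Z.- y Z.* d ≡ + 0
      cancel = solve-∀

-- The m-gonal sequence and its legal decompositions

module MGonal (m : ℕ) .{{_ : NonZero m}} where

  B : ℕ → ℕ
  B = bin m

  -- Bin c consists of the size c indices first c, …, first c + size c - 1.
  size : ℕ → ℕ
  size zero    = 1
  size (suc _) = m

  first : ℕ → ℕ
  first zero    = 0
  first (suc c) = suc (c * m)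

  size-pos : ∀ c → 0 < size c
  size-pos zero    = s≤s z≤n
  size-pos (suc _) = >-nonZero⁻¹ m

  first-suc : ∀ c → first (suc c) ≡ first c + size c
  first-suc zero    = refl
  first-suc (suc c) = cong suc (+-comm m (c * m))

  first-mono : ∀ {c c′} → c ≤ c′ → first c ≤ first c′
  first-mono {zero}           _          = z≤n
  first-mono {suc c} {suc c′} (s≤s c≤c′) = s≤s (*-monoˡ-≤ m c≤c′)

  -- index arithmetic: the t-th index of bin q + 1 is suc (q * m + t)
  quotient : ∀ q t → t < m → (q * m + t) / m ≡ q
  quotient q t t<m = begin
    (q * m + t) / m     ≡⟨ +-distrib-/-∣ˡ t (n∣m*n q) ⟩
    q * m / m + t / m   ≡⟨ cong₂ _+_ (m*n/n≡m q m) (m<n⇒m/n≡0 t<m) ⟩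
    q + 0               ≡⟨ +-identityʳ q ⟩
    q                   ∎
    where open ≡-Reasoning

  remainder : ∀ q t → t < m → (q * m + t) % m ≡ t
  remainder q t t<m = begin
    (q * m + t) % m     ≡⟨ cong (_% m) (+-comm (q * m) t) ⟩
    (t + q * m) % m     ≡⟨ [m+kn]%n≡m%n t q m ⟩
    t % m               ≡⟨ m<n⇒m%n≡m t<m ⟩
    t                   ∎
    where open ≡-Reasoning

  B-at : ∀ c t → t < size c → B (first c + t) ≡ c
  B-at zero    zero    _         = refl
  B-at zero    (suc _) (s≤s ())
  B-at (suc q) t       t<m       = cong suc (quotient q t t<m)

  data Position : ℕ → Set where
    at : ∀ c t → t < size c → Position (first c + t)

  position : ∀ ℓ → Position ℓ
  position zero    = at 0 0 (s≤s z≤n)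
  position (suc l) = subst Position (cong suc division) (at (suc (l / m)) (l % m) (m%n<n l m))
    where
    division : l / m * m + l % m ≡ l
    division = trans (+-comm (l / m * m) (l % m)) (sym (m≡m%n+[m/n]*n l m))

  start-≤ : ∀ ℓ → first (B ℓ) ≤ ℓ
  start-≤ ℓ with position ℓ
  ... | at c t t< rewrite B-at c t t< = m≤m+n (first c) t

  below-next : ∀ ℓ → ℓ < first (suc (B ℓ))
  below-next ℓ with position ℓ
  ... | at c t t< rewrite B-at c t t< | first-suc c = +-monoʳ-< (first c) t<

  bin-mono : ∀ {ℓ ℓ′} → ℓ ≤ ℓ′ → B ℓ ≤ B ℓ′
  bin-mono {zero}           _          = z≤n
  bin-mono {suc l} {suc l′} (s≤s l≤l′) = s≤s (/-monoˡ-≤ m l≤l′)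

  bin<⇒below-start : ∀ {ℓ c} → B ℓ < c → ℓ < first c
  bin<⇒below-start {ℓ} B<c = <-≤-trans (below-next ℓ) (first-mono B<c)

  below-start⇒bin< : ∀ {ℓ c} → ℓ < first c → B ℓ < c
  below-start⇒bin< {ℓ} ℓ< = ≰⇒> (λ c≤B → <⇒≱ ℓ< (≤-trans (first-mono c≤B) (start-≤ ℓ)))

  in-bin : ∀ {c y} → first c ≤ y → y < first (suc c) → Σ ℕ λ t → t < size c × first c + t ≡ y
  in-bin {c} {y} start≤y y<next =
    y ∸ first c ,
    +-cancelˡ-< (first c) _ _ (subst₂ _<_ (sym (m+[n∸m]≡n start≤y)) (first-suc c) y<next) ,
    m+[n∸m]≡n start≤y

  -- The closed form: V c is the first term of bin c and the t-th term of
  -- bin c is (t+1)·V c.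

  V : ℕ → ℕ
  V zero    = 1
  V (suc c) = suc (size c) * V c

  A : ℕ → ℕ
  A zero    = 1
  A (suc l) = suc (l % m) * V (suc (l / m))

  A-at : ∀ c t → t < size c → A (first c + t) ≡ suc t * V c
  A-at zero    zero    _         = refl
  A-at zero    (suc _) (s≤s ())
  A-at (suc q) t       t<m       = cong₂ (λ r q′ → suc r * V (suc q′)) (remainder q t t<m) (quotient q t t<m)

  V-start : ∀ c → A (first c) ≡ V c
  V-start c = trans (cong A (sym (+-identityʳ (first c))))
                    (trans (A-at c 0 (size-pos c)) (*-identityˡ (V c)))

  V-pos : ∀ c → 0 < V c
  V-pos zero    = s≤s z≤n
  V-pos (suc c) = <-≤-trans (V-pos c) (m≤m+n (V c) (size c * V c))

  A-suc : ∀ ℓ → A (suc ℓ) ≡ A ℓ + V (B ℓ)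
  A-suc ℓ with position ℓ
  ... | at c t t< = begin
    A (suc (first c + t))                  ≡⟨ cong A (sym (+-suc (first c) t)) ⟩
    A (first c + suc t)                    ≡⟨ next-term ⟩
    V c + suc t * V c                      ≡⟨ +-comm (V c) (suc t * V c) ⟩
    suc t * V c + V c                      ≡⟨ cong₂ (λ a c′ → a + V c′) (A-at c t t<) (B-at c t t<) ⟨
    A (first c + t) + V (B (first c + t))  ∎
    where
    open ≡-Reasoning
    -- the next index is either still in bin c or the first index of bin c + 1
    next-term : A (first c + suc t) ≡ V c + suc t * V c
    next-term with m≤n⇒m<n∨m≡n t<
    ... | inj₁ st<  = A-at c (suc t) st<
    ... | inj₂ st≡ = begin
      A (first c + suc t)   ≡⟨ cong (λ s → A (first c + s)) st≡ ⟩
      A (first c + size c)  ≡⟨ cong A (first-suc c) ⟨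
      A (first (suc c))     ≡⟨ V-start (suc c) ⟩
      suc (size c) * V c    ≡⟨ cong (λ s → suc s * V c) st≡ ⟨
      V c + suc t * V c     ∎

  A-pos : ∀ ℓ → 0 < A ℓ
  A-pos zero    = s≤s z≤n
  A-pos (suc ℓ) = subst (0 <_) (sym (A-suc ℓ)) (<-≤-trans (A-pos ℓ) (m≤m+n (A ℓ) _))

  A-strict : ∀ ℓ → A ℓ < A (suc ℓ)
  A-strict ℓ = subst (A ℓ <_) (sym (A-suc ℓ)) (m<m+n (A ℓ) (V-pos (B ℓ)))

  A-mono : ∀ {ℓ ℓ′} → ℓ ≤ ℓ′ → A ℓ ≤ A ℓ′
  A-mono = go ∘ ≤⇒≤′
    where
    go : ∀ {ℓ ℓ′} → ℓ ≤′ ℓ′ → A ℓ ≤ A ℓ′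
    go ≤′-refl        = ≤-refl
    go (≤′-step ℓ≤ℓ′) = ≤-trans (go ℓ≤ℓ′) (<⇒≤ (A-strict _))

  A-reflects-< : ∀ {ℓ i} → A ℓ < A i → ℓ < i
  A-reflects-< A< = ≰⇒> (λ i≤ℓ → <⇒≱ A< (A-mono i≤ℓ))

  V-bin-≤ : ∀ ℓ → V (B ℓ) ≤ A ℓ
  V-bin-≤ ℓ = subst (_≤ A ℓ) (V-start (B ℓ)) (A-mono (start-≤ ℓ))

  V-mono : ∀ {c c′} → c ≤ c′ → V c ≤ V c′
  V-mono {c} {c′} c≤c′ = subst₂ _≤_ (V-start c) (V-start c′) (A-mono (first-mono c≤c′))

  next-≤-later-bin : ∀ {ℓ c} → B ℓ < c → A (suc ℓ) ≤ V c
  next-≤-later-bin {ℓ} B<c =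
    ≤-trans (A-mono (below-next ℓ)) (≤-trans (≤-reflexive (V-start (suc (B ℓ)))) (V-mono B<c))

  -- Legal index lists and the sum bound

  Legal : List ℕ → Set
  Legal d = AllPairs _<_ d × AllPairs (λ i j → B i ≢ B j) d

  sA : List ℕ → ℕ
  sA d = sum (map A d)

  headroom : ∀ {ℓ d i x} → Legal (ℓ ∷ d) → All (_< i) (ℓ ∷ d) → x ≤ V (B ℓ) →
             sA (ℓ ∷ d) + x ≤ A i
  headroom {ℓ} {[]} {i} {x} _ (ℓ<i ∷ []) x≤ = begin
    A ℓ + 0 + x      ≡⟨ cong (_+ x) (+-identityʳ (A ℓ)) ⟩
    A ℓ + x          ≤⟨ +-monoʳ-≤ (A ℓ) x≤ ⟩
    A ℓ + V (B ℓ)    ≡⟨ A-suc ℓ ⟨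
    A (suc ℓ)        ≤⟨ A-mono ℓ<i ⟩
    A i              ∎
    where open ≤-Reasoning
  headroom {ℓ} {ℓ′ ∷ d} {i} {x} ((ℓ<ℓ′ ∷ _) ∷ inc , (ℓ≁ℓ′ ∷ _) ∷ dis) (_ ∷ below) x≤ = begin
    A ℓ + sA (ℓ′ ∷ d) + x    ≡⟨ xy∙z≈y∙xz (A ℓ) (sA (ℓ′ ∷ d)) x ⟩
    sA (ℓ′ ∷ d) + (A ℓ + x)  ≤⟨ headroom (inc , dis) below absorbed ⟩
    A i                      ∎
    where
    open ≤-Reasoning
    absorbed : A ℓ + x ≤ V (B ℓ′)
    absorbed = ≤-trans (+-monoʳ-≤ (A ℓ) x≤)
                 (≤-trans (≤-reflexive (sym (A-suc ℓ)))
                          (next-≤-later-bin (≤∧≢⇒< (bin-mono (<⇒≤ ℓ<ℓ′)) ℓ≁ℓ′)))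

  sum-bound : ∀ {d i} → Legal d → All (_< i) d → sA d < A i
  sum-bound {[]}    {i} _     _     = A-pos i
  sum-bound {ℓ ∷ d} {i} legal below =
    subst (_≤ A i) (+-comm (sA (ℓ ∷ d)) 1) (headroom legal below (V-pos (B ℓ)))

  indices-below : ∀ {i} d → sA d < A i → All (_< i) d
  indices-below []      _  = []
  indices-below (ℓ ∷ d) s< =
    A-reflects-< (≤-<-trans (m≤m+n (A ℓ) (sA d)) s<) ∷ indices-below d (≤-<-trans (m≤n+m (sA d) (A ℓ)) s<)

  indices-before-bin : ∀ {c} d → sA d < V c → All (_< first c) d
  indices-before-bin {c} d s< = indices-below d (subst (sA d <_) (sym (V-start c)) s<)

  unsnoc-legal : ∀ ds y → Legal (ds ∷ʳ y) → Legal ds × All (_< first (B y)) ds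
  unsnoc-legal ds y (inc , dis) with AllPairs-∷ʳ⁻ ds inc | AllPairs-∷ʳ⁻ ds dis
  ... | inc′ , ds<y | dis′ , ds≁y = (inc′ , dis′) , All.zipWith before-bin (ds<y , ds≁y)
    where
    before-bin : ∀ {e} → e < y × B e ≢ B y → e < first (B y)
    before-bin (e<y , e≁y) = bin<⇒below-start (≤∧≢⇒< (bin-mono (<⇒≤ e<y)) e≁y)

  snoc : ∀ {x z} y (d : LegalDec m A x) → All (_< first (B y)) (idx d) → x + A y ≡ z → LegalDec m A z
  snoc y d below total = legalDec (idx d ∷ʳ y)
    (APP.++⁺ (increasing d) ([] ∷ []) (All.map (λ e< → <-≤-trans e< (start-≤ y) ∷ []) below))
    (APP.++⁺ (distinctBins d) ([] ∷ []) (All.map (λ e< → <⇒≢ (below-start⇒bin< e<) ∷ []) below))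
    (trans (sum-map-∷ʳ A (idx d) y) (trans (cong (_+ A y) (sums d)) total))

  -- Every z < A i is a legal sum of terms below index i (greedily: split off
  -- A j when z ≥ A j, the remainder being less than the first term of j's bin).

  represent : ∀ i z → z < A i → LegalDecUsing m A i z
  represent zero    zero    _        = legalDec [] [] [] refl , []
  represent zero    (suc _) (s≤s ())
  represent (suc j) z z< with z <? A j
  ... | yes z<Aj = Product.map₂ (All.map m<n⇒m<1+n) (represent j z z<Aj)
  ... | no  z≮Aj = snoc j d below (m∸n+n≡m Aj≤z) ,
                   AllP.∷ʳ⁺ (All.map (λ e< → ≤-trans e< (≤-trans (start-≤ j) (n≤1+n j))) below) (n<1+n j)
    where
    Aj≤z : A j ≤ z
    Aj≤z = ≮⇒≥ z≮Aj
    rest< : z ∸ A j < V (B j)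
    rest< = +-cancelˡ-< (A j) _ _ (subst₂ _<_ (sym (m+[n∸m]≡n Aj≤z)) (A-suc j) z<)
    d : LegalDec m A (z ∸ A j)
    d = proj₁ (represent j (z ∸ A j) (<-≤-trans rest< (V-bin-≤ j)))
    below : All (_< first (B j)) (idx d)
    below = indices-before-bin (idx d) (subst (_< V (B j)) (sym (sums d)) rest<)

  retarget : ∀ {f g z} (d : LegalDec m f z) → All (λ j → f j ≡ g j) (idx d) → LegalDec m g z
  retarget d agree =
    legalDec (idx d) (increasing d) (distinctBins d) (trans (cong sum (sym (map-cong-local agree))) (sums d))

  retarget-using : ∀ {f g i z} → (∀ {j} → j < i → f j ≡ g j) → LegalDecUsing m f i z → LegalDecUsing m g i z
  retarget-using agree (d , below) = retarget d (All.map agree below) , below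

  -- The m-gonal sequence is A: by strong induction, a i < A i would make a i
  -- representable, and a i > A i would make A i a legal sum below A i.
  mgonal≡A : ∀ a → IsMGonalSequence m a → ∀ i → a i ≡ A i
  mgonal≡A a mgonal = <-rec (λ i → a i ≡ A i) step
    where
    step : ∀ i → (∀ {j} → j < i → a j ≡ A j) → a i ≡ A i
    step i agree with mgonal i | <-cmp (a i) (A i)
    ... | _ , unrepresentable , _ | tri< a<A _ _ =
      ⊥-elim (unrepresentable (retarget-using (sym ∘ agree) (represent i (a i) a<A)))
    ... | _ , _ , _ | tri≈ _ a≡A _ = a≡A
    ... | _ , _ , representable | tri> _ _ A<a
      with retarget-using agree (representable (A i) (A-pos i) A<a)
    ...   | d , below = ⊥-elim (<-irrefl (sums d) (sum-bound (increasing d , distinctBins d) below))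

  -- Enumerating the z < V c with a legal decomposition of k terms: such a
  -- decomposition avoids bin c, or ends with its t-th term (t+1)·V c.

  L : ℕ → ℕ → List ℕ
  L zero    zero    = 0 ∷ []
  L zero    (suc _) = []
  L (suc c) zero    = L c zero
  L (suc c) (suc k) = L c (suc k) ++ blocks (V c) (L c k) (size c)

  L-length : ∀ c k → length (L (suc c) (suc k)) ≡ length (L c (suc k)) + size c * length (L c k)
  L-length c k = trans (length-++ (L c (suc k)))
                       (cong (length (L c (suc k)) +_) (blocks-length (V c) (L c k) (size c)))

  extend-in-bin : ∀ c t {x k} → t < size c → x < V c × LegalDecWith m A x k →
                  suc t * V c + x < V (suc c) × LegalDecWith m A (suc t * V c + x) (suc k)
  extend-in-bin c t {x} t< (x< , d , len) =
    block-bound t< x< ,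
    snoc y d below (trans (+-comm x (A y)) (cong (_+ x) (A-at c t t<))) ,
    trans (length-∷ʳ (idx d) y) (cong suc len)
    where
    y : ℕ
    y = first c + t
    below : All (_< first (B y)) (idx d)
    below = subst (λ c′ → All (_< first c′) (idx d)) (sym (B-at c t t<))
              (indices-before-bin (idx d) (subst (_< V c) (sym (sums d)) x<))

  L-sound : ∀ c k {z} → z ∈ L c k → z < V c × LegalDecWith m A z k
  L-sound zero    zero    (here refl) = s≤s z≤n , legalDec [] [] [] refl , refl
  L-sound (suc c) zero    z∈          = Product.map₁ (λ z< → <-≤-trans z< (m≤m+n (V c) _)) (L-sound c zero z∈)
  L-sound (suc c) (suc k) z∈ with ∈-++⁻ (L c (suc k)) z∈
  ... | inj₁ z∈old = Product.map₁ (λ z< → <-≤-trans z< (m≤m+n (V c) _)) (L-sound c (suc k) z∈old)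
  ... | inj₂ z∈new with blocks-mem⁻ (size c) z∈new
  ...   | t , x , t< , x∈ , refl = extend-in-bin c t t< (L-sound c k x∈)

  L-bound : ∀ c k → All (_< V c) (L c k)
  L-bound c k = All.tabulate (proj₁ ∘ L-sound c k)

  L-sorted : ∀ c k → AllPairs _<_ (L c k)
  L-sorted zero    zero    = [] ∷ []
  L-sorted zero    (suc k) = []
  L-sorted (suc c) zero    = L-sorted c zero
  L-sorted (suc c) (suc k) =
    APP.++⁺ (L-sorted c (suc k)) (blocks-sorted (size c) (L-bound c k) (L-sorted c k))
      (All.map (λ z< → All.map (λ bounds → <-≤-trans z< (proj₁ bounds)) (blocks-bounds (size c) (L-bound c k)))
               (L-bound c (suc k)))

  L-complete    : ∀ c d → Legal d → sA d < V c → sA d ∈ L c (length d)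
  L-complete-∷ʳ : ∀ c ds y → Legal (ds ∷ʳ y) → sA (ds ∷ʳ y) < V (suc c) →
                  sA (ds ∷ʳ y) ∈ L (suc c) (suc (length ds))

  L-complete zero    []      _     _ = here refl
  -- a nonempty sum is positive
  L-complete zero    (ℓ ∷ d) _     (s≤s s≤0) =
    ⊥-elim (<⇒≱ (A-pos ℓ) (≤-trans (m≤m+n (A ℓ) (sA d)) s≤0))
  L-complete (suc c) d       legal s< with initLast d
  ... | []       = L-complete c [] legal (V-pos c)
  ... | ds ∷ʳ′ y =
    subst (λ k → sA (ds ∷ʳ y) ∈ L (suc c) k) (sym (length-∷ʳ ds y)) (L-complete-∷ʳ c ds y legal s<)

  L-complete-∷ʳ c ds y legal s< with unsnoc-legal ds y legal | y <? first c
  ... | _ , ds-before | yes y<start =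
    ∈-++⁺ˡ (subst (λ k → sA (ds ∷ʳ y) ∈ L c k) (length-∷ʳ ds y) (L-complete c (ds ∷ʳ y) legal s<V))
    where
    -- the whole decomposition avoids bin c
    s<V : sA (ds ∷ʳ y) < V c
    s<V = subst (sA (ds ∷ʳ y) <_) (V-start c) (sum-bound legal
            (AllP.∷ʳ⁺ (All.map (λ e< → <-trans e< (≤-<-trans (start-≤ y) y<start)) ds-before) y<start))
  ... | ds-legal , ds-before | no y≮start
    with in-bin (≮⇒≥ y≮start) (proj₂ (AllP.∷ʳ⁻ (indices-before-bin {suc c} (ds ∷ʳ y) s<)))
  ...   | t , t< , refl =
    subst (_∈ L (suc c) (suc (length ds))) (sym total)
      (∈-++⁺ʳ (L c (suc (length ds))) (blocks-mem⁺ (size c) t< (L-complete c ds ds-legal ds<V)))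
    where
    total : sA (ds ∷ʳ (first c + t)) ≡ suc t * V c + sA ds
    total = trans (sum-map-∷ʳ A ds (first c + t)) (trans (+-comm (sA ds) _) (cong (_+ sA ds) (A-at c t t<)))
    ds<V : sA ds < V c
    ds<V = subst (sA ds <_) (V-start c)
             (sum-bound ds-legal (subst (λ c′ → All (_< first c′) ds) (B-at c t t<) ds-before))

  enumerates : ∀ a → (∀ i → a i ≡ A i) → ∀ c k →
               IsCount (V c) (λ z → LegalDecWith m a z k) (length (L c k))
  enumerates a a≡A c k = L c k , AP.map <⇒≢ (L-sorted c k) , refl , λ z → mk⇔ (sound z) (complete z)
    where
    sound : ∀ z → z ∈ L c k → z < V c × LegalDecWith m a z k
    sound z z∈ with L-sound c k z∈
    ... | z< , d , len = z< , retarget d (All.universal (sym ∘ a≡A) (idx d)) , len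
    complete : ∀ z → z < V c × LegalDecWith m a z k → z ∈ L c k
    complete z (z< , d , len) =
      subst₂ (λ z′ k′ → z′ ∈ L c k′) (sums dA) len
        (L-complete c (idx d) (increasing d , distinctBins d) (subst (_< V c) (sym (sums dA)) z<))
      where
      dA : LegalDec m A z
      dA = retarget d (All.universal a≡A (idx d))

proposition2p8 : (m : ℕ) → .{{_ : NonZero m}} → (a : ℕ → ℕ) → IsMGonalSequence m a →
    Σ (ℕ → ℕ → ℕ) λ p →
      (∀ n k → IsCount (a (m * n + 1)) (λ z → LegalDecWith m a z k) (p n k))
      × (genFun p *ₛ (1ₛ -ₛ (m ·ₛ Yₛ +ₛ 1ₛ) *ₛ Xₛ) ≈ₛ 1ₛ +ₛ Yₛ)
proposition2p8 m a mgonal = p , counts , series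
  where
  open MGonal m
  -- p n k counts the z < V (n+1) = a_{mn+1} with k terms
  p : ℕ → ℕ → ℕ
  p n k = length (L (suc n) k)

  a≡A : ∀ i → a i ≡ A i
  a≡A = mgonal≡A a mgonal

  a-start : ∀ n → a (m * n + 1) ≡ V (suc n)
  a-start n = trans (a≡A (m * n + 1))
                (trans (cong A (trans (+-comm (m * n) 1) (cong suc (*-comm m n)))) (V-start (suc n)))

  counts : ∀ n k → IsCount (a (m * n + 1)) (λ z → LegalDecWith m a z k) (p n k)
  counts n k = subst (λ N → IsCount N (λ z → LegalDecWith m a z k) (p n k)) (sym (a-start n))
                     (enumerates a a≡A (suc n) k)

  series : genFun p *ₛ (1ₛ -ₛ (m ·ₛ Yₛ +ₛ 1ₛ) *ₛ Xₛ) ≈ₛ 1ₛ +ₛ Yₛ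
  series = PowerSeries.recurrence⇒series m p refl refl (λ _ → refl) (λ _ → refl) (λ n k → L-length (suc n) k)
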